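{- Let $\mathtt{vtm} = v_0v_1v_2\cdots = 012021012102012\cdots$ be the fixed point $\tau^\omega(0)$ of the morphism $\tau$ on $\{0,1,2\}^*$ defined by $\tau(0)=012$, $\tau(1)=02$, $\tau(2)=1$. Then for each integer $k\geq 2$, the word $[\mathtt{vtm}]_k = v_0v_kv_{2k}\cdots$ contains the square $00$ or the square $22$ as a factor.
   Context: For an infinite word $w=w_0w_1w_2\cdots$ (each $w_i$ a letter) and a positive integer $p$, $[w]_p$ denotes the infinite word $w_0w_pw_{2p}\cdots$. The fixed point $\tau^\omega(0)$ is the infinite word obtained as the limit of $\tau^n(0)$, which exists since $\tau(0)$ begins with $0$. -}

module Defs where

open import Data.Nat using (ℕ; zero; suc; _+_; _*_)
open import Data.Fin using (Fin; zero; suc)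
open import Data.List using (List; []; _∷_; concatMap)
open import Data.Product using (Σ; _×_)
open import Relation.Binary.PropositionalEquality using (_≡_; refl)

Letter : Set
Letter = Fin 3

τ : Letter → List Letter
τ zero = zero ∷ suc zero ∷ suc (suc zero) ∷ []
τ (suc zero) = zero ∷ suc (suc zero) ∷ []
τ (suc (suc zero)) = suc zero ∷ []

τ* : List Letter → List Letter
τ* = concatMap τ

τⁿ0 : ℕ → List Letter
τⁿ0 zero = zero ∷ []
τⁿ0 (suc n) = τ* (τⁿ0 n)

-- i-th letter of a finite word (default 0 when out of range; never used below)
at : List Letter → ℕ → Letter
at [] _ = zero
at (x ∷ xs) zero = x
at (x ∷ xs) (suc i) = at xs i

-- vtm = τ^ω(0): its i-th letter v_i is the i-th letter of τ^(i+1)(0),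
-- which has length > i and is a prefix of τ^ω(0)
vtm : ℕ → Letter
vtm i = at (τⁿ0 (suc i)) i

decimate : (ℕ → Letter) → ℕ → ℕ → Letter
decimate w p i = w (i * p)

containsSquare : (ℕ → Letter) → Letter → Set
containsSquare u a = Σ ℕ (λ j → (u j ≡ a) × (u (suc j) ≡ a))

private
  open import Data.Fin using (toℕ)
  open import Data.List using (map; upTo)
  sanity : map (λ i → toℕ (vtm i)) (upTo 15) ≡ 0 ∷ 1 ∷ 2 ∷ 0 ∷ 2 ∷ 1 ∷ 0 ∷ 1 ∷ 2 ∷ 1 ∷ 0 ∷ 2 ∷ 0 ∷ 1 ∷ 2 ∷ []
  sanity = refl

-- vtm is the difference sequence of the Thue–Morse word t, v i = 1 + t i − t (i + 1): that
-- word is a fixed point of τ, the image of its letter at s sitting at position 2s + t s.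
-- So v x ∈ {0, 2} exactly when t flips at x, and v x = v y ∈ {0, 2} when t flips at x and
-- at y and t x = t y. The word t flips at every even position, and t (G 2^M + L) = t G + t L
-- for L < 2^M. For even k take x = k, y = 2k. For odd k ≥ 5 write L + k = 2^M + 3 with L
-- even and x = G 2^M + L; then x and x + k = (G + 1) 2^M + 3 are flips, and t x = t (x + k)
-- reduces to t (G + 1) = t G + t L, which holds for all G in a suitable class mod 4. As 2 is
-- invertible mod k, some such G makes x a multiple of k. The case k = 3 is checked directly.
module Submission where

open import Defs
open import Data.Fin using (zero; suc)
open import Data.List using (_++_; _∷ʳ_; [_]; length; applyUpTo)
open import Data.List.Properties using (++-assoc; ++-identityʳ; applyUpTo-∷ʳ; concatMap-++)
open import Data.Nat using (ℕ; zero; suc; _+_; _*_; _^_; _≤_; _<_; z≤n; s≤s; ⌊_/2⌋; parity)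
open import Data.Nat.Properties
open import Data.Nat.Tactic.RingSolver using (solve-∀)
open import Data.Parity.Base using (Parity; 0ℙ; 1ℙ; _⁻¹) renaming (_+_ to _⊕_)
import Data.Parity.Properties as ℙ
open import Data.Product using (∃; ∃₂; _,_)
open import Data.Sum using (_⊎_; inj₁; inj₂)
open import Relation.Nullary using (contradiction)
open import Relation.Binary.PropositionalEquality using (_≡_; refl; sym; trans; cong; cong₂; subst; module ≡-Reasoning)
open ≡-Reasoning

-- Thue–Morse as the parity of the binary digit sum; fuel f suffices once n ≤ f.
thueMorseWithin : ℕ → ℕ → Parity
thueMorseWithin zero    n = 0ℙ
thueMorseWithin (suc f) n = parity n ⊕ thueMorseWithin f ⌊ n /2⌋

thueMorse : ℕ → Parity
thueMorse n = thueMorseWithin n n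

thueMorseWithin-0 : ∀ f → thueMorseWithin f 0 ≡ 0ℙ
thueMorseWithin-0 zero    = refl
thueMorseWithin-0 (suc f) = thueMorseWithin-0 f

⌊1+n/2⌋≤n : ∀ n → ⌊ suc n /2⌋ ≤ n
⌊1+n/2⌋≤n n = m<1+n⇒m≤n (⌊n/2⌋<n n)

thueMorseWithin-fuel : ∀ {f g n} → n ≤ f → n ≤ g → thueMorseWithin f n ≡ thueMorseWithin g n
thueMorseWithin-fuel {f} {g} {zero} _ _ = trans (thueMorseWithin-0 f) (sym (thueMorseWithin-0 g))
thueMorseWithin-fuel {suc f} {suc g} {suc n} (s≤s n≤f) (s≤s n≤g) =
  cong (parity (suc n) ⊕_)
    (thueMorseWithin-fuel (≤-trans (⌊1+n/2⌋≤n n) n≤f) (≤-trans (⌊1+n/2⌋≤n n) n≤g))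

thueMorse-unfold : ∀ n → thueMorse n ≡ parity n ⊕ thueMorse ⌊ n /2⌋
thueMorse-unfold zero    = refl
thueMorse-unfold (suc n) = cong (parity (suc n) ⊕_) (thueMorseWithin-fuel (⌊1+n/2⌋≤n n) ≤-refl)

parity-double : ∀ n → parity (n + n) ≡ 0ℙ
parity-double n = trans (ℙ.+-homo-+ n n) (ℙ.p+p≡0ℙ (parity n))

thueMorse-double : ∀ n → thueMorse (n + n) ≡ thueMorse n
thueMorse-double n = begin
  thueMorse (n + n)                       ≡⟨ thueMorse-unfold (n + n) ⟩
  parity (n + n) ⊕ thueMorse ⌊ n + n /2⌋  ≡⟨ cong₂ _⊕_ (parity-double n) (cong thueMorse (sym (n≡⌊n+n/2⌋ n))) ⟩
  0ℙ ⊕ thueMorse n                        ∎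

thueMorse-double+1 : ∀ n → thueMorse (suc (n + n)) ≡ thueMorse n ⁻¹
thueMorse-double+1 n = begin
  thueMorse (suc (n + n))                             ≡⟨ thueMorse-unfold (suc (n + n)) ⟩
  parity (suc (n + n)) ⊕ thueMorse ⌊ suc (n + n) /2⌋  ≡⟨ cong₂ _⊕_ parity-odd (cong thueMorse (sym (n≡⌈n+n/2⌉ n))) ⟩
  1ℙ ⊕ thueMorse n                                    ∎
  where
  parity-odd : parity (suc (n + n)) ≡ 1ℙ
  parity-odd = trans (ℙ.+-homo-+ 1 (n + n)) (cong _⁻¹ (parity-double n))

data Halving : ℕ → Set where
  even : ∀ h → Halving (h + h)
  odd  : ∀ h → Halving (suc (h + h))

halving : ∀ n → Halving n
halving zero    = even 0
halving (suc n) with halving n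
... | even h = odd h
... | odd h  = subst Halving (cong suc (+-suc h h)) (even (suc h))

half-<-2^ : ∀ M {h} → h + h < 2 ^ suc M → h < 2 ^ M
half-<-2^ M lt = ≰⇒> λ P≤h →
  <⇒≱ lt (≤-trans (≤-reflexive (cong (2 ^ M +_) (+-identityʳ _))) (+-mono-≤ P≤h P≤h))

⊕-⁻¹ : ∀ p q → (p ⊕ q) ⁻¹ ≡ p ⊕ q ⁻¹
⊕-⁻¹ 0ℙ q = refl
⊕-⁻¹ 1ℙ q = refl

thueMorse-append : ∀ M H {L} → L < 2 ^ M → thueMorse (H * 2 ^ M + L) ≡ thueMorse H ⊕ thueMorse L
thueMorse-append zero    H {zero}  _        =
  trans (cong thueMorse (trans (+-identityʳ _) (*-identityʳ H))) (sym (ℙ.+-identityʳ _))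
thueMorse-append zero    H {suc L} (s≤s ())
thueMorse-append (suc M) H {L}     L<2^M+1 with halving L | L<2^M+1
... | even h | lt = begin
  thueMorse (H * 2 ^ suc M + (h + h))      ≡⟨ cong thueMorse (shape H (2 ^ M) h) ⟩
  thueMorse (w + w)                        ≡⟨ thueMorse-double w ⟩
  thueMorse w                              ≡⟨ thueMorse-append M H (half-<-2^ M lt) ⟩
  thueMorse H ⊕ thueMorse h                ≡⟨ cong (thueMorse H ⊕_) (thueMorse-double h) ⟨
  thueMorse H ⊕ thueMorse (h + h)          ∎
  where
  w = H * 2 ^ M + h
  shape : ∀ H P h → H * (2 * P) + (h + h) ≡ (H * P + h) + (H * P + h)
  shape = solve-∀
... | odd h  | lt = begin
  thueMorse (H * 2 ^ suc M + suc (h + h))  ≡⟨ cong thueMorse (shape H (2 ^ M) h) ⟩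
  thueMorse (suc (w + w))                  ≡⟨ thueMorse-double+1 w ⟩
  thueMorse w ⁻¹                           ≡⟨ cong _⁻¹ (thueMorse-append M H (half-<-2^ M (<-trans (n<1+n _) lt))) ⟩
  (thueMorse H ⊕ thueMorse h) ⁻¹           ≡⟨ ⊕-⁻¹ (thueMorse H) (thueMorse h) ⟩
  thueMorse H ⊕ thueMorse h ⁻¹             ≡⟨ cong (thueMorse H ⊕_) (thueMorse-double+1 h) ⟨
  thueMorse H ⊕ thueMorse (suc (h + h))    ∎
  where
  w = H * 2 ^ M + h
  shape : ∀ H P h → H * (2 * P) + suc (h + h) ≡ suc ((H * P + h) + (H * P + h))
  shape = solve-∀

Flips : ℕ → Set
Flips i = thueMorse (suc i) ≡ thueMorse i ⁻¹

flips-double : ∀ n → Flips (n + n)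
flips-double n = trans (thueMorse-double+1 n) (cong _⁻¹ (sym (thueMorse-double n)))

flips-append : ∀ M H {L} → suc L < 2 ^ M → Flips L → Flips (H * 2 ^ M + L)
flips-append M H {L} sL<P flipsL = begin
  thueMorse (suc (H * 2 ^ M + L))   ≡⟨ cong thueMorse (+-suc (H * 2 ^ M) L) ⟨
  thueMorse (H * 2 ^ M + suc L)     ≡⟨ thueMorse-append M H sL<P ⟩
  thueMorse H ⊕ thueMorse (suc L)   ≡⟨ cong (thueMorse H ⊕_) flipsL ⟩
  thueMorse H ⊕ thueMorse L ⁻¹      ≡⟨ ⊕-⁻¹ (thueMorse H) (thueMorse L) ⟨
  (thueMorse H ⊕ thueMorse L) ⁻¹    ≡⟨ cong _⁻¹ (thueMorse-append M H (<-trans (n<1+n L) sL<P)) ⟨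
  thueMorse (H * 2 ^ M + L) ⁻¹      ∎

-- Δ p q is the letter 1 + p − q.
Δ : Parity → Parity → Letter
Δ 0ℙ 1ℙ = zero
Δ 1ℙ 0ℙ = suc (suc zero)
Δ _  _  = suc zero

δ : ℕ → Letter
δ i = Δ (thueMorse i) (thueMorse (suc i))

δ-double : ∀ s → δ (s + s) ≡ Δ (thueMorse s) (thueMorse s ⁻¹)
δ-double s = cong₂ Δ (thueMorse-double s) (thueMorse-double+1 s)

δ-double+1 : ∀ s → δ (suc (s + s)) ≡ Δ (thueMorse s ⁻¹) (thueMorse (suc s))
δ-double+1 s = cong₂ Δ (thueMorse-double+1 s)
  (trans (cong thueMorse (cong suc (sym (+-suc s s)))) (thueMorse-double (suc s)))

δ-double+2 : ∀ s → δ (suc (suc (s + s))) ≡ Δ (thueMorse (suc s)) (thueMorse (suc s) ⁻¹)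
δ-double+2 s = trans (cong δ (cong suc (sym (+-suc s s)))) (δ-double (suc s))

bit : Parity → ℕ
bit 0ℙ = 0
bit 1ℙ = 1

start : ℕ → ℕ
start s = bit (thueMorse s) + (s + s)

τ-δ : ∀ s → τ (δ s) ≡ applyUpTo (λ i → δ (i + start s)) (length (τ (δ s)))
τ-δ s = image (thueMorse s) (thueMorse (suc s)) refl refl
  where
  image : ∀ a b → thueMorse s ≡ a → thueMorse (suc s) ≡ b →
          τ (Δ a b) ≡ applyUpTo (λ i → δ (i + (bit a + (s + s)))) (length (τ (Δ a b)))
  image 0ℙ 0ℙ p q rewrite δ-double s | δ-double+1 s | p | q = refl
  image 0ℙ 1ℙ p q rewrite δ-double s | δ-double+1 s | δ-double+2 s | p | q = refl
  image 1ℙ 0ℙ p q rewrite δ-double+1 s | p | q = refl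
  image 1ℙ 1ℙ p q rewrite δ-double+1 s | δ-double+2 s | p | q = refl

start-suc : ∀ s → start (suc s) ≡ length (τ (δ s)) + start s
start-suc s = trans (cong (λ n → bit (thueMorse (suc s)) + suc n) (+-suc s s))
                    (step (thueMorse s) (thueMorse (suc s)))
  where
  step : ∀ a b → bit b + suc (suc (s + s)) ≡ length (τ (Δ a b)) + (bit a + (s + s))
  step 0ℙ 0ℙ = refl
  step 0ℙ 1ℙ = refl
  step 1ℙ 0ℙ = refl
  step 1ℙ 1ℙ = refl

applyUpTo-++ : ∀ {A : Set} (f : ℕ → A) m n →
               applyUpTo f m ++ applyUpTo (λ i → f (i + m)) n ≡ applyUpTo f (n + m)
applyUpTo-++ f m zero    = ++-identityʳ (applyUpTo f m)
applyUpTo-++ f m (suc n) = begin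
  applyUpTo f m ++ applyUpTo g (suc n)            ≡⟨ cong (applyUpTo f m ++_) (applyUpTo-∷ʳ g n) ⟨
  applyUpTo f m ++ (applyUpTo g n ∷ʳ f (n + m))   ≡⟨ ++-assoc (applyUpTo f m) (applyUpTo g n) [ f (n + m) ] ⟨
  (applyUpTo f m ++ applyUpTo g n) ∷ʳ f (n + m)   ≡⟨ cong (_∷ʳ f (n + m)) (applyUpTo-++ f m n) ⟩
  applyUpTo f (n + m) ∷ʳ f (n + m)                ≡⟨ applyUpTo-∷ʳ f (n + m) ⟩
  applyUpTo f (suc n + m)                         ∎
  where
  g = λ i → f (i + m)

τ*-prefix : ∀ n → τ* (applyUpTo δ n) ≡ applyUpTo δ (start n)
τ*-prefix zero    = refl
τ*-prefix (suc n) = begin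
  τ* (applyUpTo δ (suc n))                   ≡⟨ cong τ* (applyUpTo-∷ʳ δ n) ⟨
  τ* (applyUpTo δ n ∷ʳ δ n)                  ≡⟨ concatMap-++ τ (applyUpTo δ n) [ δ n ] ⟩
  τ* (applyUpTo δ n) ++ τ* [ δ n ]           ≡⟨ cong₂ _++_ (τ*-prefix n) (++-identityʳ (τ (δ n))) ⟩
  applyUpTo δ (start n) ++ τ (δ n)           ≡⟨ cong (applyUpTo δ (start n) ++_) (τ-δ n) ⟩
  applyUpTo δ (start n) ++ applyUpTo (λ i → δ (i + start n)) (length (τ (δ n)))
                                             ≡⟨ applyUpTo-++ δ (start n) (length (τ (δ n))) ⟩
  applyUpTo δ (length (τ (δ n)) + start n)   ≡⟨ cong (applyUpTo δ) (start-suc n) ⟨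
  applyUpTo δ (start (suc n))                ∎

prefixLength : ℕ → ℕ
prefixLength zero    = 1
prefixLength (suc n) = start (prefixLength n)

τⁿ0≡prefix : ∀ n → τⁿ0 n ≡ applyUpTo δ (prefixLength n)
τⁿ0≡prefix zero    = refl
τⁿ0≡prefix (suc n) = trans (cong τ* (τⁿ0≡prefix n)) (τ*-prefix (prefixLength n))

n<prefixLength : ∀ n → n < prefixLength n
n<prefixLength zero    = s≤s z≤n
n<prefixLength (suc n) =
  ≤-trans (s≤s (m≤n+m (suc n) n))
    (≤-trans (+-mono-≤ (n<prefixLength n) (n<prefixLength n)) (m≤n+m _ (bit (thueMorse ℓ))))
  where
  ℓ = prefixLength n

at-applyUpTo : ∀ (f : ℕ → Letter) {n i} → i < n → at (applyUpTo f n) i ≡ f i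
at-applyUpTo f {suc n} {zero}  _        = refl
at-applyUpTo f {suc n} {suc i} (s≤s lt) = at-applyUpTo (λ j → f (suc j)) lt

vtm≡δ : ∀ i → vtm i ≡ δ i
vtm≡δ i = trans (cong (λ w → at w i) (τⁿ0≡prefix (suc i)))
                (at-applyUpTo δ (<-trans (n<1+n i) (n<prefixLength (suc i))))

Has00or22 : ℕ → Set
Has00or22 k = containsSquare (decimate vtm k) zero ⊎ containsSquare (decimate vtm k) (suc (suc zero))

square-Δ : ∀ {u : ℕ → Letter} p j → u j ≡ Δ p (p ⁻¹) → u (suc j) ≡ Δ p (p ⁻¹) →
           containsSquare u zero ⊎ containsSquare u (suc (suc zero))
square-Δ 0ℙ j uj usj = inj₁ (j , uj , usj)
square-Δ 1ℙ j uj usj = inj₂ (j , uj , usj)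

vtm-flip : ∀ i → Flips i → vtm i ≡ Δ (thueMorse i) (thueMorse i ⁻¹)
vtm-flip i flips = trans (vtm≡δ i) (cong (Δ (thueMorse i)) flips)

square-at : ∀ {k x} j → x ≡ j * k → Flips x → Flips (k + x) → thueMorse x ≡ thueMorse (k + x) →
            Has00or22 k
square-at {k} j refl flips flips′ same = square-Δ (thueMorse (j * k)) j (vtm-flip (j * k) flips)
  (trans (vtm-flip (k + j * k) flips′) (cong (λ p → Δ p (p ⁻¹)) (sym same)))

even-square : ∀ h → Has00or22 (h + h)
even-square h = square-at 1 (sym (+-identityʳ (h + h))) (flips-double h) (flips-double (h + h))
  (sym (thueMorse-double (h + h)))

-- 2 (m + 1) ≡ 1 (mod 2m + 1), so multiplying by m + 1 extends an inverse of 2^e to 2^(e + 1).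
2^-invertible-mod-odd : ∀ m e → ∃₂ λ u s → u * 2 ^ e ≡ s * suc (m + m) + 1
2^-invertible-mod-odd m zero    = 1 , 0 , refl
2^-invertible-mod-odd m (suc e) with 2^-invertible-mod-odd m e
... | u , s , u2^e≡ = u * suc m , s * k + s + 1 , (begin
  u * suc m * (2 * 2 ^ e)    ≡⟨ shape₁ u m (2 ^ e) ⟩
  u * 2 ^ e * suc k          ≡⟨ cong (_* suc k) u2^e≡ ⟩
  (s * k + 1) * suc k        ≡⟨ shape₂ s k ⟩
  (s * k + s + 1) * k + 1    ∎)
  where
  k = suc (m + m)
  shape₁ : ∀ u m P → u * suc m * (2 * P) ≡ u * P * suc (suc (m + m))
  shape₁ = solve-∀
  shape₂ : ∀ s k → (s * k + 1) * suc k ≡ (s * k + s + 1) * k + 1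
  shape₂ = solve-∀

-- With u 2^e ≡ 1 and 2m ≡ −1 (mod 2m + 1), H = 2m u L gives H 2^e + L ≡ 0.
multiple-of-odd-≡-mod-2^ : ∀ m e L → ∃₂ λ H j → j * suc (m + m) ≡ H * 2 ^ e + L
multiple-of-odd-≡-mod-2^ m e L with 2^-invertible-mod-odd m e
... | u , s , u2^e≡ = u * L * (m + m) , L * (m + m) * s + L , (begin
  (L * (m + m) * s + L) * k         ≡⟨ shape₁ L (m + m) s ⟩
  L * (m + m) * (s * k + 1) + L     ≡⟨ cong (λ n → L * (m + m) * n + L) u2^e≡ ⟨
  L * (m + m) * (u * 2 ^ e) + L     ≡⟨ shape₂ L (m + m) u (2 ^ e) ⟩
  u * L * (m + m) * 2 ^ e + L       ∎)
  where
  k = suc (m + m)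
  shape₁ : ∀ L n s → (L * n * s + L) * suc n ≡ L * n * (s * suc n + 1) + L
  shape₁ = solve-∀
  shape₂ : ∀ L n u P → L * n * (u * P) + L ≡ u * L * n * P + L
  shape₂ = solve-∀

stepOffset : Parity → ℕ
stepOffset 0ℙ = 1
stepOffset 1ℙ = 0

thueMorse-step : ∀ p H → thueMorse (suc (H * 4 + stepOffset p)) ≡ thueMorse (H * 4 + stepOffset p) ⊕ p
thueMorse-step p H = begin
  thueMorse (suc (H * 4 + r))          ≡⟨ cong thueMorse (+-suc (H * 4) r) ⟨
  thueMorse (H * 4 + suc r)            ≡⟨ thueMorse-append 2 H (suc-stepOffset<4 p) ⟩
  thueMorse H ⊕ thueMorse (suc r)      ≡⟨ cong (thueMorse H ⊕_) (stepOffset-step p) ⟩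
  thueMorse H ⊕ (thueMorse r ⊕ p)      ≡⟨ ℙ.+-assoc (thueMorse H) (thueMorse r) p ⟨
  (thueMorse H ⊕ thueMorse r) ⊕ p      ≡⟨ cong (_⊕ p) (thueMorse-append 2 H (<-trans (n<1+n r) (suc-stepOffset<4 p))) ⟨
  thueMorse (H * 4 + r) ⊕ p            ∎
  where
  r = stepOffset p
  suc-stepOffset<4 : ∀ p → suc (stepOffset p) < 4
  suc-stepOffset<4 0ℙ = s≤s (s≤s (s≤s z≤n))
  suc-stepOffset<4 1ℙ = s≤s (s≤s z≤n)
  stepOffset-step : ∀ p → thueMorse (suc (stepOffset p)) ≡ thueMorse (stepOffset p) ⊕ p
  stepOffset-step 0ℙ = refl
  stepOffset-step 1ℙ = refl

L+k≡P+3⇒1+L<P : ∀ {m L P} → 2 ≤ m → L + suc (m + m) ≡ P + 3 → suc L < P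
L+k≡P+3⇒1+L<P {m} {L} {P} 2≤m L+k≡ = +-cancelʳ-≤ 3 (2 + L) P
  (≤-trans (≤-reflexive (shape L)) (≤-trans (+-monoʳ-≤ L (s≤s (+-mono-≤ 2≤m 2≤m))) (≤-reflexive L+k≡)))
  where
  shape : ∀ L → 2 + L + 3 ≡ L + 5
  shape = solve-∀

4<2^ : ∀ {M} → 3 ≤ M → 4 < 2 ^ M
4<2^ 3≤M = ≤-trans (s≤s (s≤s (s≤s (s≤s (s≤s z≤n))))) (^-monoʳ-≤ 2 3≤M)

odd-square : ∀ {m M L} → 2 ≤ m → 3 ≤ M → L + suc (m + m) ≡ 2 ^ M + 3 → Flips L →
             Has00or22 (suc (m + m))
odd-square {m} {M} {L} 2≤m 3≤M L+k≡ flipsL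
  with multiple-of-odd-≡-mod-2^ m (2 + M) (stepOffset (thueMorse L) * 2 ^ M + L)
... | H , j , jk≡ = square-at j x≡jk (flips-append M G sL<P flipsL) flips-k+x (begin
  thueMorse x                          ≡⟨ thueMorse-append M G (<-trans (n<1+n L) sL<P) ⟩
  thueMorse G ⊕ thueMorse L            ≡⟨ thueMorse-step (thueMorse L) H ⟨
  thueMorse (suc G)                    ≡⟨ ℙ.+-identityʳ (thueMorse (suc G)) ⟨
  thueMorse (suc G) ⊕ thueMorse 3      ≡⟨ thueMorse-append M (suc G) 3<P ⟨
  thueMorse (suc G * P + 3)            ≡⟨ cong thueMorse k+x≡ ⟨
  thueMorse (k + x)                    ∎)
  where
  k = suc (m + m)
  P = 2 ^ M
  G = H * 4 + stepOffset (thueMorse L)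
  x = G * P + L

  x≡jk : x ≡ j * k
  x≡jk = sym (trans jk≡ (shape H (stepOffset (thueMorse L)) P L))
    where
    shape : ∀ H r P L → H * (2 * (2 * P)) + (r * P + L) ≡ (H * 4 + r) * P + L
    shape = solve-∀

  k+x≡ : k + x ≡ suc G * P + 3
  k+x≡ = begin
    k + (G * P + L)      ≡⟨ shape₁ k (G * P) L ⟩
    G * P + (L + k)      ≡⟨ cong (G * P +_) L+k≡ ⟩
    G * P + (P + 3)      ≡⟨ shape₂ G P ⟩
    suc G * P + 3        ∎
    where
    shape₁ : ∀ k y L → k + (y + L) ≡ y + (L + k)
    shape₁ = solve-∀
    shape₂ : ∀ G P → G * P + (P + 3) ≡ suc G * P + 3
    shape₂ = solve-∀

  sL<P : suc L < P
  sL<P = L+k≡P+3⇒1+L<P 2≤m L+k≡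

  3<P : 3 < P
  3<P = <-trans (n<1+n 3) (4<2^ 3≤M)

  flips-k+x : Flips (k + x)
  flips-k+x = subst Flips (sym k+x≡) (flips-append M (suc G) {3} (4<2^ 3≤M) refl)

n≤2^n : ∀ n → n ≤ 2 ^ n
n≤2^n zero    = z≤n
n≤2^n (suc n) = +-mono-≤ (m^n>0 2 n) (≤-trans (n≤2^n n) (m≤m+n (2 ^ n) 0))

even-complement : ∀ m → ∃ λ L₂ → (L₂ + L₂) + suc (m + m) ≡ 2 ^ suc m + 3
even-complement m with m≤n⇒∃[o]m+o≡n (n≤2^n m)
... | o , m+o≡2^m = suc o , (begin
  (suc o + suc o) + suc (m + m)   ≡⟨ shape m o ⟩
  2 * (m + o) + 3                 ≡⟨ cong (λ n → 2 * n + 3) m+o≡2^m ⟩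
  2 * 2 ^ m + 3                   ∎)
  where
  shape : ∀ m o → (suc o + suc o) + suc (m + m) ≡ 2 * (m + o) + 3
  shape = solve-∀

mainTheorem1 : (k : ℕ) → 2 ≤ k →
    containsSquare (decimate vtm k) zero ⊎ containsSquare (decimate vtm k) (suc (suc zero))
mainTheorem1 k 2≤k with halving k
... | even h               = even-square h
... | odd zero             = contradiction 2≤k λ { (s≤s ()) }
... | odd (suc zero)       = inj₁ (0 , refl , refl)
... | odd m@(suc (suc _)) with even-complement m
...   | L₂ , L+k≡ = odd-square {M = suc m} (s≤s (s≤s z≤n)) (s≤s (s≤s (s≤s z≤n))) L+k≡ (flips-double L₂)
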